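{- Let $f(m,n)=\left\lceil \frac{mn+4}{2m+2n}\right\rceil$ for positive integers $m,n$. For positive integers $n,r$ with $r<n/2$, the largest positive integer $m$ such that $f(m,n)=r$ is $\left\lfloor \frac{2rn-4}{n-2r}\right\rfloor$. -}

module Defs where

open import Data.Nat using (ℕ; suc; _+_; _*_; _∸_; _≤_; NonZero)
open import Data.Nat.DivMod using (_/_)
open import Data.Product using (_×_)
open import Relation.Binary.PropositionalEquality using (_≡_)

⌈_/_⌉ : (a b : ℕ) → .{{NonZero b}} → ℕ
⌈ a / b ⌉ = (a + b ∸ 1) / b

-- f(m,n) = ⌈ (mn+4) / (2m+2n) ⌉ for positive integers m, n
-- (m = 0 gets a junk value 0; f is only ever used at positive m)
f : (m n : ℕ) → ℕ
f 0 n = 0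
f (suc m) n = ⌈ (suc m * n + 4) / (2 * suc m + 2 * n) ⌉

IsLargest : (n r m : ℕ) → Set
IsLargest n r m = (1 ≤ m) × (f m n ≡ r) × (∀ m′ → 1 ≤ m′ → f m′ n ≡ r → m′ ≤ m)

-- Put n = 2r + D with D ≥ 1 and K = 2rn − 4. Then r(2m + 2n) − (mn + 4) = K − mD, so
-- mn + 4 ≤ r(2m + 2n), i.e. f(m,n) ≤ r, holds exactly when m ≤ K / D. At m = K / D the
-- slack K − mD = K mod D is below D ≤ 2m + 2n, which forces f(m,n) > r − 1.
module Submission where

open import Defs
open import Data.Nat using (ℕ; suc; _+_; _*_; _∸_; _≤_; _<_; NonZero; >-nonZero⁻¹)
open import Data.Nat.DivMod
  using (_/_; _%_; m≡m%n+[m/n]*n; m%n<n; m/n*n≤m; m*n/n≡m; /-monoˡ-≤; m<n*o⇒m/o<n; m≥n⇒m/n>0)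
open import Data.Nat.Properties
open import Data.Nat.Tactic.RingSolver using (solve-∀)
open import Data.Product using (_,_)
open import Relation.Binary.PropositionalEquality

m*n≤o⇒m≤o/n : ∀ m n o .{{_ : NonZero n}} → m * n ≤ o → m ≤ o / n
m*n≤o⇒m≤o/n m n o le = subst (_≤ o / n) (m*n/n≡m m n) (/-monoˡ-≤ n le)

m<m/n*n+n : ∀ m n .{{_ : NonZero n}} → m < m / n * n + n
m<m/n*n+n m n = begin-strict
  m                 ≡⟨ m≡m%n+[m/n]*n m n ⟩
  m % n + m / n * n ≡⟨ +-comm (m % n) _ ⟩
  m / n * n + m % n <⟨ +-monoʳ-< (m / n * n) (m%n<n m n) ⟩
  m / n * n + n     ∎
  where open ≤-Reasoning

⌈/⌉-numerator : ∀ a b .{{_ : NonZero b}} → suc (a + b ∸ 1) ≡ a + b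
⌈/⌉-numerator a b = m+[n∸m]≡n (≤-trans (>-nonZero⁻¹ b) (m≤n+m b a))

a≤⌈a/b⌉*b : ∀ a b .{{_ : NonZero b}} → a ≤ ⌈ a / b ⌉ * b
a≤⌈a/b⌉*b a b = +-cancelʳ-≤ b a (⌈ a / b ⌉ * b) (begin
  a + b             ≡⟨ ⌈/⌉-numerator a b ⟨
  suc (a + b ∸ 1)   ≤⟨ m<m/n*n+n (a + b ∸ 1) b ⟩
  ⌈ a / b ⌉ * b + b ∎)
  where open ≤-Reasoning

⌈/⌉-unique : ∀ a b q .{{_ : NonZero b}} → a ≤ q * b → q * b < a + b → ⌈ a / b ⌉ ≡ q
⌈/⌉-unique a b q a≤qb qb<a+b = ≤-antisym ⌈a/b⌉≤q q≤⌈a/b⌉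
  where
  open ≤-Reasoning
  ⌈a/b⌉≤q : ⌈ a / b ⌉ ≤ q
  ⌈a/b⌉≤q = <⇒≤pred (m<n*o⇒m/o<n (begin-strict
    a + b ∸ 1 <⟨ ≤-reflexive (⌈/⌉-numerator a b) ⟩
    a + b     ≤⟨ +-monoˡ-≤ b a≤qb ⟩
    q * b + b ≡⟨ +-comm (q * b) b ⟩
    suc q * b ∎))
  q≤⌈a/b⌉ : q ≤ ⌈ a / b ⌉
  q≤⌈a/b⌉ = m*n≤o⇒m≤o/n q b (a + b ∸ 1)
    (<⇒≤pred (subst (q * b <_) (sym (⌈/⌉-numerator a b)) qb<a+b))

module _ {n r D K : ℕ} (2r+D≡n : 2 * r + D ≡ n) (K+4≡2rn : K + 4 ≡ 2 * r * n) where

  -- Both sides equal 2rm + mD + 2rn; this is r(2m + 2n) − (mn + 4) = K − mD without subtraction.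
  balance : ∀ m → m * n + 4 + K ≡ r * (2 * m + 2 * n) + m * D
  balance m = begin
    m * n + 4 + K                ≡⟨ +-assoc (m * n) 4 K ⟩
    m * n + (4 + K)              ≡⟨ cong (m * n +_) (trans (+-comm 4 K) K+4≡2rn) ⟩
    m * n + 2 * r * n            ≡⟨ subst (λ x → m * x + 2 * r * x ≡ r * (2 * m + 2 * x) + m * D)
                                      2r+D≡n (identity m r D) ⟩
    r * (2 * m + 2 * n) + m * D  ∎
    where
    open ≡-Reasoning
    identity : ∀ m r D →
      m * (2 * r + D) + 2 * r * (2 * r + D) ≡ r * (2 * m + 2 * (2 * r + D)) + m * D
    identity = solve-∀

  f≡r⇒m*D≤K : ∀ m → 1 ≤ m → f m n ≡ r → m * D ≤ K
  f≡r⇒m*D≤K m@(suc _) _ f≡r = +-cancelˡ-≤ (r * b) (m * D) K (begin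
    r * b + m * D  ≡⟨ balance m ⟨
    a + K          ≡⟨ +-comm a K ⟩
    K + a          ≤⟨ +-monoʳ-≤ K (subst (λ q → a ≤ q * b) f≡r (a≤⌈a/b⌉*b a b)) ⟩
    K + r * b      ≡⟨ +-comm K (r * b) ⟩
    r * b + K      ∎)
    where
    open ≤-Reasoning
    a b : ℕ
    a = m * n + 4
    b = 2 * m + 2 * n

  m*D≤K⇒f≡r : ∀ m → 1 ≤ m → m * D ≤ K → K < m * D + D → f m n ≡ r
  m*D≤K⇒f≡r m@(suc _) _ mD≤K K<mD+D = ⌈/⌉-unique a b r a≤rb rb<a+b
    where
    open ≤-Reasoning
    a b : ℕ
    a = m * n + 4
    b = 2 * m + 2 * n
    D≤b : D ≤ b
    D≤b = begin
      D         ≤⟨ m≤n+m D (2 * r) ⟩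
      2 * r + D ≡⟨ 2r+D≡n ⟩
      n         ≤⟨ m≤n+m n (2 * m) ⟩
      2 * m + n ≤⟨ +-monoʳ-≤ (2 * m) (m≤m+n n (n + 0)) ⟩
      b         ∎
    a≤rb : a ≤ r * b
    a≤rb = +-cancelʳ-≤ K a (r * b) (begin
      a + K          ≡⟨ balance m ⟩
      r * b + m * D  ≤⟨ +-monoʳ-≤ (r * b) mD≤K ⟩
      r * b + K      ∎)
    rb<a+b : r * b < a + b
    rb<a+b = +-cancelʳ-< (m * D) (r * b) (a + b) (begin-strict
      r * b + m * D      ≡⟨ balance m ⟨
      a + K              <⟨ +-monoʳ-< a (≤-trans K<mD+D (+-monoʳ-≤ (m * D) D≤b)) ⟩
      a + (m * D + b)    ≡⟨ cong (a +_) (+-comm (m * D) b) ⟩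
      a + (b + m * D)    ≡⟨ +-assoc a b (m * D) ⟨
      a + b + m * D      ∎)

2r+D≡n⇒D+4≤2rn : ∀ {n r D} → 1 ≤ r → 2 * r + D ≡ n → D + 4 ≤ 2 * r * n
2r+D≡n⇒D+4≤2rn {n} {r} {D} 1≤r 2r+D≡n = begin
  D + 4          ≡⟨ +-assoc D 2 2 ⟨
  D + 2 + 2      ≤⟨ +-monoˡ-≤ 2 D+2≤n ⟩
  n + 2          ≤⟨ +-monoʳ-≤ n (≤-trans (m≤n+m 2 D) D+2≤n) ⟩
  n + n          ≡⟨ cong (n +_) (+-identityʳ n) ⟨
  2 * n          ≤⟨ *-monoˡ-≤ n (*-monoʳ-≤ 2 1≤r) ⟩
  2 * r * n      ∎
  where
  open ≤-Reasoning
  D+2≤n : D + 2 ≤ n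
  D+2≤n = begin
    D + 2     ≤⟨ +-monoʳ-≤ D (*-monoʳ-≤ 2 1≤r) ⟩
    D + 2 * r ≡⟨ +-comm D (2 * r) ⟩
    2 * r + D ≡⟨ 2r+D≡n ⟩
    n         ∎

lemma8 : (n r : ℕ) → 1 ≤ n → 1 ≤ r → 2 * r < n →
    .{{_ : NonZero (n ∸ 2 * r)}} →
    IsLargest n r ((2 * r * n ∸ 4) / (n ∸ 2 * r))
lemma8 n r _ 1≤r 2r<n = 1≤M , f[M]≡r , λ m 1≤m f[m]≡r →
  m*n≤o⇒m≤o/n m D K (f≡r⇒m*D≤K 2r+D≡n K+4≡2rn m 1≤m f[m]≡r)
  where
  D K M : ℕ
  D = n ∸ 2 * r
  K = 2 * r * n ∸ 4
  M = K / D
  2r+D≡n : 2 * r + D ≡ n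
  2r+D≡n = m+[n∸m]≡n (<⇒≤ 2r<n)
  D+4≤2rn : D + 4 ≤ 2 * r * n
  D+4≤2rn = 2r+D≡n⇒D+4≤2rn 1≤r 2r+D≡n
  K+4≡2rn : K + 4 ≡ 2 * r * n
  K+4≡2rn = m∸n+n≡m (≤-trans (m≤n+m 4 D) D+4≤2rn)
  1≤M : 1 ≤ M
  1≤M = m≥n⇒m/n>0 (+-cancelʳ-≤ 4 D K (subst (D + 4 ≤_) (sym K+4≡2rn) D+4≤2rn))
  f[M]≡r : f M n ≡ r
  f[M]≡r = m*D≤K⇒f≡r 2r+D≡n K+4≡2rn M 1≤M (m/n*n≤m K D) (m<m/n*n+n K D)
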